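{- Let $\tau$ be a forcibly self-complementary degree sequence and $G$ a realization of $\tau$. Then the degree sequence of every slice of $G$ is forcibly self-complementary.
   Context: Graphs are finite and simple; a graph is self-complementary if it is isomorphic to its complement. A degree sequence is the non-increasing list of vertex degrees of a graph; a realization is any graph with that degree sequence; a degree sequence is forcibly self-complementary if all its realizations are self-complementary. If $G$ is a self-complementary graph with $\ell$ distinct degrees $d_1>d_2>\dots>d_\ell$, let $V_i=\{v\in V(G): d(v)=d_i\}$; the $i$th slice of $G$ is the induced subgraph $S_i=G[V_i\cup V_{\ell+1-i}]$ for $i=1,\dots,\ell$. -}

module Defs where

open import Data.Bool using (Bool; true; false; not; if_then_else_; _∨_)
open import Data.Nat using (ℕ; _≟_)
open import Data.Nat.Properties using (≤-decTotalOrder)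
open import Data.Fin using (Fin; opposite) renaming (_≟_ to _≟ᶠ_)
open import Data.List using (List; length; map; filter; lookup; allFin; reverse; deduplicate; sum)
open import Data.Product using (∃; _,_; proj₂)
import Data.Empty
import Relation.Nullary
open import Relation.Binary.PropositionalEquality using (_≡_)
open import Relation.Nullary.Decidable using (⌊_⌋; T?)
open import Data.Fin.Permutation using (Permutation′; _⟨$⟩ʳ_)
import Data.List.Sort as Sort
open Sort ≤-decTotalOrder using (sort)

record Graph (n : ℕ) : Set where
  field
    adj    : Fin n → Fin n → Bool
    sym    : ∀ u v → adj u v ≡ adj v u
    irrefl : ∀ v → adj v v ≡ false
open Graph public

deg : ∀ {n} → Graph n → Fin n → ℕ
deg G v = length (filter (λ w → T? (adj G v w)) (allFin _))

degSeq : ∀ {n} → Graph n → List ℕ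
degSeq G = reverse (sort (map (deg G) (allFin _)))

complement : ∀ {n} → Graph n → Graph n
complement {n} G = record
  { adj = cadj
  ; sym = csym
  ; irrefl = cirr }
  where
  cadj : Fin n → Fin n → Bool
  cadj u v = if ⌊ u ≟ᶠ v ⌋ then false else not (adj G u v)
  csym : ∀ u v → cadj u v ≡ cadj v u
  csym u v with u ≟ᶠ v | v ≟ᶠ u
  ... | Relation.Nullary.yes _ | Relation.Nullary.yes _ = Relation.Binary.PropositionalEquality.refl
  ... | Relation.Nullary.yes p | Relation.Nullary.no q = Data.Empty.⊥-elim (q (Relation.Binary.PropositionalEquality.sym p))
  ... | Relation.Nullary.no q | Relation.Nullary.yes p = Data.Empty.⊥-elim (q (Relation.Binary.PropositionalEquality.sym p))
  ... | Relation.Nullary.no _ | Relation.Nullary.no _ =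
        Relation.Binary.PropositionalEquality.cong not (sym G u v)
  cirr : ∀ v → cadj v v ≡ false
  cirr v with v ≟ᶠ v
  ... | Relation.Nullary.yes _ = Relation.Binary.PropositionalEquality.refl
  ... | Relation.Nullary.no ¬p = Data.Empty.⊥-elim (¬p Relation.Binary.PropositionalEquality.refl)

_≅_ : ∀ {n} → Graph n → Graph n → Set
_≅_ {n} G H = ∃ λ (σ : Permutation′ n) → ∀ u v → adj H (σ ⟨$⟩ʳ u) (σ ⟨$⟩ʳ v) ≡ adj G u v

SelfComplementary : ∀ {n} → Graph n → Set
SelfComplementary G = G ≅ complement G

Realizes : ∀ {n} → Graph n → List ℕ → Set
Realizes G τ = degSeq G ≡ τ

ForciblySelfComplementary : List ℕ → Set
ForciblySelfComplementary τ = ∀ n (H : Graph n) → Realizes H τ → SelfComplementary H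

induced : ∀ {n} → Graph n → (L : List (Fin n)) → Graph (length L)
induced G L = record
  { adj = λ i j → adj G (lookup L i) (lookup L j)
  ; sym = λ i j → sym G (lookup L i) (lookup L j)
  ; irrefl = λ i → irrefl G (lookup L i) }

distinctDegrees : ∀ {n} → Graph n → List ℕ
distinctDegrees G = deduplicate _≟_ (degSeq G)

numDegrees : ∀ {n} → Graph n → ℕ
numDegrees G = length (distinctDegrees G)

-- the i-th slice S_i = G[V_i ∪ V_{ℓ+1-i}]  (i : Fin ℓ, 0-indexed; ℓ+1-i corresponds to opposite i)
slice : ∀ {n} (G : Graph n) → Fin (numDegrees G) → ∃ Graph
slice G i = _ , induced G (filter (λ v → T? (⌊ deg G v ≟ lookup ds i ⌋ ∨ ⌊ deg G v ≟ lookup ds (opposite i) ⌋)) (allFin _))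
  where ds = distinctDegrees G

{-# OPTIONS --safe #-}
-- Let a and b be the i-th largest and the i-th smallest distinct degree of G, so the slice S is
-- induced on the vertices of degree a or b. A complementing permutation of a self-complementary
-- graph on n vertices sends a vertex of degree d to one of degree n - 1 - d; hence the distinct
-- degrees are symmetric under d ↦ n - 1 - d and a + b = n - 1. Now let H realize the degree
-- sequence of S, and replace S inside G by a copy of H matched to S by a degree-preserving
-- bijection. No vertex changes its degree, so the new graph G′ still realizes τ and is
-- self-complementary. Because a + b = n - 1, its complementing permutation maps the vertices of
-- degree a or b onto themselves, so it restricts to a complementing permutation of the copy of H.
module Submission where

open import Data.Bool using (Bool; true; false; not; if_then_else_; _∨_; T)
open import Data.Bool.Properties using (T-irrelevant; ∨-comm)
open import Data.Empty using (⊥-elim)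
open import Data.Fin as Fin using (Fin; zero; suc; opposite) renaming (_≟_ to _≟ᶠ_)
open import Data.Fin.Permutation as Perm
  using (Permutation; Permutation′; _⟨$⟩ʳ_; _⟨$⟩ˡ_; inverseˡ; inverseʳ; _∘ₚ_; cast-id)
open import Data.Fin.Properties
  using (suc-injective; cast-involutive; opposite-prop; opposite-involutive; toℕ<n)
open import Data.List using (List; _∷_; length; map; filter; lookup; allFin; tabulate; reverse; deduplicate)
open import Data.List.Membership.Propositional using (_∈_)
open import Data.List.Membership.Propositional.Properties
  using ( ∈-lookup; ∈-filter⁺; ∈-filter⁻; ∈-allFin; ∈-deduplicate⁻; ∈-deduplicate⁺
        ; ∈-tabulate⁺; ∈-tabulate⁻)
open import Data.List.Properties using (length-tabulate; lookup-tabulate; map-tabulate; map-cong; unfold-reverse)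
open import Data.List.Relation.Binary.Permutation.Propositional
  using (_↭_; ↭-sym; ↭-trans; ↭-reflexive; ↭⇒↭ₛ; module PermutationReasoning)
open import Data.List.Relation.Binary.Permutation.Propositional.Properties using (↭-reverse; ∈-resp-↭)
import Data.List.Relation.Unary.All as All
open import Data.List.Relation.Unary.AllPairs using (AllPairs; []; _∷_)
import Data.List.Relation.Unary.AllPairs.Properties as AllPairsₚ
import Data.List.Relation.Unary.Any as Any
open import Data.List.Relation.Unary.Any.Properties using (lookup-index)
open import Data.List.Relation.Unary.Sorted.TotalOrder.Properties using (Sorted⇒AllPairs)
open import Data.List.Relation.Unary.Unique.Propositional using (Unique)
import Data.List.Relation.Unary.Unique.Propositional.Properties as Uniqueₚ
open import Data.Nat as ℕ using (ℕ; _+_; _∸_; _≤_; _<_; _≥_; _>_; _≟_; s≤s; z<s; s<s)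
open import Data.Nat.Properties as ℕₚ
  using ( +-comm; +-identityʳ; +-cancelˡ-≡; +-cancelʳ-≡; ≤-refl; <⇒≤; <-irrefl; ≤-antisym; ≤∧≢⇒<
        ; ∸-monoʳ-<; m≤n+m; m+[n∸m]≡n; m+n∸m≡n; ≤-decTotalOrder; ≤-totalOrder)
open import Algebra.Properties.CommutativeMonoid.Sum ℕₚ.+-0-commutativeMonoid
  using (sum; sum-permute; ∑-distrib-+; sum-cong-≗)
open import Data.List.Sort ≤-decTotalOrder using (sort; sort-↭; sort-↗)
open import Data.Product using (∃; Σ; _,_; proj₁; proj₂)
open import Data.Sum using (_⊎_; inj₁; inj₂)
open import Function using (_∘_; id; flip)
open import Function.Bundles using (_⇔_; mk⇔)
open import Level using (0ℓ)
open import Relation.Binary.Core using (Rel)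
open import Relation.Binary.PropositionalEquality
open import Relation.Nullary using (Dec; yes; no; ¬_; ¬?)
open import Relation.Nullary.Decidable using (⌊_⌋; ⌊⌋-map′; does-⇔; isYes≗does; T?)

open import Defs hiding (sym)

indicator : Bool → ℕ
indicator b = if b then 1 else 0

∑-one : ∀ n → sum {n} (λ _ → 1) ≡ n
∑-one ℕ.zero    = refl
∑-one (ℕ.suc n) = cong ℕ.suc (∑-one n)

∑-filter-tabulate : ∀ {m} {A : Set} (g : Fin m → A) (p : A → Bool) (h : A → ℕ) →
                    sum (h ∘ lookup (filter (λ x → T? (p x)) (tabulate g)))
                      ≡ sum (λ i → if p (g i) then h (g i) else 0)
∑-filter-tabulate {ℕ.zero}  g p h = refl
∑-filter-tabulate {ℕ.suc m} g p h with p (g zero)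
... | true  = cong (h (g zero) +_) (∑-filter-tabulate (g ∘ suc) p h)
... | false = ∑-filter-tabulate (g ∘ suc) p h

deg≡∑ : ∀ {n} (G : Graph n) v → deg G v ≡ sum (λ w → indicator (adj G v w))
deg≡∑ G v = trans (sym (∑-one _)) (∑-filter-tabulate id (adj G v) (λ _ → 1))

deg-cong : ∀ {n} (G G′ : Graph n) {u} → (∀ w → adj G u w ≡ adj G′ u w) → deg G u ≡ deg G′ u
deg-cong G G′ {u} e = begin
  deg G u                             ≡⟨ deg≡∑ G u ⟩
  sum (λ w → indicator (adj G u w))   ≡⟨ sum-cong-≗ (cong indicator ∘ e) ⟩
  sum (λ w → indicator (adj G′ u w))  ≡⟨ deg≡∑ G′ u ⟨
  deg G′ u                            ∎
  where open ≡-Reasoning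

∑-indicator-≢ : ∀ {n} (v : Fin (ℕ.suc n)) → sum (λ w → indicator (not ⌊ v ≟ᶠ w ⌋)) ≡ n
∑-indicator-≢ {n}       zero    = ∑-one n
∑-indicator-≢ {ℕ.suc n} (suc v) = cong ℕ.suc (begin
  sum (λ w → indicator (not ⌊ suc v ≟ᶠ suc w ⌋))
    ≡⟨ sum-cong-≗ (λ w → cong (indicator ∘ not) (⌊⌋-map′ (cong suc) suc-injective (v ≟ᶠ w))) ⟩
  sum (λ w → indicator (not ⌊ v ≟ᶠ w ⌋))
    ≡⟨ ∑-indicator-≢ v ⟩
  n ∎)
  where open ≡-Reasoning

suc-deg-complement+deg : ∀ {n} (G : Graph n) v → ℕ.suc (deg (complement G) v + deg G v) ≡ n
suc-deg-complement+deg {ℕ.suc n} G v = cong ℕ.suc (begin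
  deg (complement G) v + deg G v
    ≡⟨ cong₂ _+_ (deg≡∑ (complement G) v) (deg≡∑ G v) ⟩
  sum (λ w → indicator (adj (complement G) v w)) + sum (λ w → indicator (adj G v w))
    ≡⟨ ∑-distrib-+ (λ w → indicator (adj (complement G) v w)) (λ w → indicator (adj G v w)) ⟨
  sum (λ w → indicator (adj (complement G) v w) + indicator (adj G v w))
    ≡⟨ sum-cong-≗ exactly-one ⟩
  sum (λ w → indicator (not ⌊ v ≟ᶠ w ⌋))
    ≡⟨ ∑-indicator-≢ v ⟩
  n ∎)
  where
  open ≡-Reasoning
  exactly-one : ∀ w → indicator (adj (complement G) v w) + indicator (adj G v w) ≡ indicator (not ⌊ v ≟ᶠ w ⌋)
  exactly-one w with v ≟ᶠ w
  ... | yes refl = cong indicator (irrefl G v)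
  ... | no _ with adj G v w
  ...   | true  = refl
  ...   | false = refl

deg<n : ∀ {n} (G : Graph n) v → deg G v < n
deg<n G v = subst (deg G v <_) (suc-deg-complement+deg G v) (s≤s (m≤n+m (deg G v) (deg (complement G) v)))

⌊⌋-⇔ : ∀ {A B : Set} → A ⇔ B → (a? : Dec A) (b? : Dec B) → ⌊ a? ⌋ ≡ ⌊ b? ⌋
⌊⌋-⇔ A⇔B a? b? = trans (isYes≗does a?) (trans (does-⇔ A⇔B a? b?) (sym (isYes≗does b?)))

_≅[_]_ : ∀ {m n} → Graph m → Permutation m n → Graph n → Set
G ≅[ σ ] H = ∀ u v → adj H (σ ⟨$⟩ʳ u) (σ ⟨$⟩ʳ v) ≡ adj G u v

⟨$⟩ʳ-injective : ∀ {m n} (σ : Permutation m n) {u v} → σ ⟨$⟩ʳ u ≡ σ ⟨$⟩ʳ v → u ≡ v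
⟨$⟩ʳ-injective σ {u} {v} e = begin
  u                  ≡⟨ inverseˡ σ ⟨
  σ ⟨$⟩ˡ (σ ⟨$⟩ʳ u)  ≡⟨ cong (σ ⟨$⟩ˡ_) e ⟩
  σ ⟨$⟩ˡ (σ ⟨$⟩ʳ v)  ≡⟨ inverseˡ σ ⟩
  v                  ∎
  where open ≡-Reasoning

deg-≅ : ∀ {m n} (G : Graph m) (H : Graph n) (σ : Permutation m n) → G ≅[ σ ] H →
        ∀ u → deg H (σ ⟨$⟩ʳ u) ≡ deg G u
deg-≅ G H σ G≅H u = begin
  deg H (σ ⟨$⟩ʳ u)                                     ≡⟨ deg≡∑ H _ ⟩
  sum (λ w → indicator (adj H (σ ⟨$⟩ʳ u) w))           ≡⟨ sum-permute _ σ ⟩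
  sum (λ w → indicator (adj H (σ ⟨$⟩ʳ u) (σ ⟨$⟩ʳ w)))  ≡⟨ sum-cong-≗ (cong indicator ∘ G≅H u) ⟩
  sum (λ w → indicator (adj G u w))                    ≡⟨ deg≡∑ G u ⟨
  deg G u                                              ∎
  where open ≡-Reasoning

complement-≅ : ∀ {m n} (G : Graph m) (H : Graph n) (σ : Permutation m n) → G ≅[ σ ] H →
               complement G ≅[ σ ] complement H
complement-≅ G H σ G≅H u v =
  cong₂ (λ b c → if b then false else not c)
        (⌊⌋-⇔ (mk⇔ (⟨$⟩ʳ-injective σ) (cong (σ ⟨$⟩ʳ_))) (σ ⟨$⟩ʳ u ≟ᶠ σ ⟨$⟩ʳ v) (u ≟ᶠ v))
        (G≅H u v)

selfComplementary-≅ : ∀ {m n} (G : Graph m) (H : Graph n) (φ : Permutation m n) → G ≅[ φ ] H →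
                      SelfComplementary G → SelfComplementary H
selfComplementary-≅ G H φ G≅H (ρ , G≅Gᶜ) = Perm.flip φ ∘ₚ ρ ∘ₚ φ , λ x y → begin
  adj (complement H) (φ ⟨$⟩ʳ (ρ ⟨$⟩ʳ (φ ⟨$⟩ˡ x))) (φ ⟨$⟩ʳ (ρ ⟨$⟩ʳ (φ ⟨$⟩ˡ y)))
    ≡⟨ complement-≅ G H φ G≅H _ _ ⟩
  adj (complement G) (ρ ⟨$⟩ʳ (φ ⟨$⟩ˡ x)) (ρ ⟨$⟩ʳ (φ ⟨$⟩ˡ y))
    ≡⟨ G≅Gᶜ _ _ ⟩
  adj G (φ ⟨$⟩ˡ x) (φ ⟨$⟩ˡ y)
    ≡⟨ G≅H _ _ ⟨
  adj H (φ ⟨$⟩ʳ (φ ⟨$⟩ˡ x)) (φ ⟨$⟩ʳ (φ ⟨$⟩ˡ y))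
    ≡⟨ cong₂ (adj H) (inverseʳ φ) (inverseʳ φ) ⟩
  adj H x y ∎
  where open ≡-Reasoning

suc-deg+deg-selfComplementary : ∀ {n} (G : Graph n) (σ : Permutation′ n) → G ≅[ σ ] complement G →
                                ∀ u → ℕ.suc (deg G (σ ⟨$⟩ʳ u) + deg G u) ≡ n
suc-deg+deg-selfComplementary {n} G σ G≅Gᶜ u = begin
  ℕ.suc (deg G (σ ⟨$⟩ʳ u) + deg G u)
    ≡⟨ cong (λ d → ℕ.suc (deg G (σ ⟨$⟩ʳ u) + d)) (deg-≅ G (complement G) σ G≅Gᶜ u) ⟨
  ℕ.suc (deg G (σ ⟨$⟩ʳ u) + deg (complement G) (σ ⟨$⟩ʳ u))
    ≡⟨ cong ℕ.suc (+-comm (deg G _) _) ⟩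
  ℕ.suc (deg (complement G) (σ ⟨$⟩ʳ u) + deg G (σ ⟨$⟩ʳ u))
    ≡⟨ suc-deg-complement+deg G _ ⟩
  n ∎
  where open ≡-Reasoning

module _ {A : Set} where
  open import Data.List.Relation.Binary.Permutation.Setoid (setoid A) using (onIndices)
  open import Data.List.Relation.Binary.Permutation.Setoid.Properties (setoid A) using (onIndices-lookup)

  tabulate-↭⇒permutation : ∀ {m n} (f : Fin m → A) (g : Fin n → A) → tabulate f ↭ tabulate g →
                            Σ (Permutation m n) λ π → ∀ i → g (π ⟨$⟩ʳ i) ≡ f i
  tabulate-↭⇒permutation f g f↭g = cast-id (sym |f|) ∘ₚ π ∘ₚ cast-id |g| , matches
    where
    |f| = length-tabulate f
    |g| = length-tabulate g
    π = onIndices (↭⇒↭ₛ f↭g)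
    matches : ∀ i → g (Fin.cast |g| (π ⟨$⟩ʳ Fin.cast (sym |f|) i)) ≡ f i
    matches i = begin
      g (Fin.cast |g| (π ⟨$⟩ʳ i′))
        ≡⟨ lookup-tabulate g _ ⟨
      lookup (tabulate g) (Fin.cast (sym |g|) (Fin.cast |g| (π ⟨$⟩ʳ i′)))
        ≡⟨ cong (lookup (tabulate g)) (cast-involutive (sym |g|) |g| _) ⟩
      lookup (tabulate g) (π ⟨$⟩ʳ i′)
        ≡⟨ onIndices-lookup (↭⇒↭ₛ f↭g) i′ ⟨
      lookup (tabulate f) i′
        ≡⟨ lookup-tabulate f i ⟩
      f i ∎
      where
      open ≡-Reasoning
      i′ = Fin.cast (sym |f|) i

tabulate-deg↭degSeq : ∀ {n} (G : Graph n) → tabulate (deg G) ↭ degSeq G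
tabulate-deg↭degSeq {n} G = begin
  tabulate (deg G)               ≡⟨ map-tabulate id (deg G) ⟨
  map (deg G) (allFin n)         ↭⟨ sort-↭ _ ⟨
  sort (map (deg G) (allFin n))  ↭⟨ ↭-reverse _ ⟨
  degSeq G                       ∎
  where open PermutationReasoning

degSeq-≡⇒degree-preserving-bijection : ∀ {m n} (G : Graph m) (H : Graph n) → degSeq G ≡ degSeq H →
                                       Σ (Permutation m n) λ φ → ∀ k → deg H (φ ⟨$⟩ʳ k) ≡ deg G k
degSeq-≡⇒degree-preserving-bijection G H e =
  tabulate-↭⇒permutation (deg G) (deg H)
    (↭-trans (tabulate-deg↭degSeq G) (↭-trans (↭-reflexive e) (↭-sym (tabulate-deg↭degSeq H))))

degSeq-cong : ∀ {n} (G H : Graph n) → (∀ v → deg G v ≡ deg H v) → degSeq G ≡ degSeq H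
degSeq-cong {n} G H e = cong (reverse ∘ sort) (map-cong e (allFin n))

lookup-injective : ∀ {A : Set} {xs : List A} → Unique xs → ∀ {i j} → lookup xs i ≡ lookup xs j → i ≡ j
lookup-injective {xs = _ ∷ _}  _        {zero}  {zero}  _ = refl
lookup-injective {xs = _ ∷ _}  (x∉ ∷ _) {zero}  {suc j} e = ⊥-elim (All.lookup x∉ (∈-lookup j) e)
lookup-injective {xs = _ ∷ _}  (x∉ ∷ _) {suc i} {zero}  e = ⊥-elim (All.lookup x∉ (∈-lookup i) (sym e))
lookup-injective {xs = _ ∷ xs} (_ ∷ u)  {suc i} {suc j} e = cong suc (lookup-injective u e)

module Members {n : ℕ} (P : Fin n → Bool) where

  members : List (Fin n)
  members = filter (λ v → T? (P v)) (allFin n)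

  ι : Fin (length members) → Fin n
  ι = lookup members

  ι-injective : ∀ {k l} → ι k ≡ ι l → k ≡ l
  ι-injective = lookup-injective (Uniqueₚ.filter⁺ (λ v → T? (P v)) (Uniqueₚ.allFin⁺ n))

  P-ι : ∀ k → T (P (ι k))
  P-ι k = proj₂ (∈-filter⁻ (λ v → T? (P v)) {xs = allFin n} (∈-lookup k))

  index : ∀ v → T (P v) → Fin (length members)
  index v p = Any.index (∈-filter⁺ (λ v → T? (P v)) (∈-allFin v) p)

  ι-index : ∀ v p → ι (index v p) ≡ v
  ι-index v p = sym (lookup-index (∈-filter⁺ (λ v → T? (P v)) (∈-allFin v) p))

  index-ι : ∀ k p → index (ι k) p ≡ k
  index-ι k p = ι-injective (ι-index (ι k) p)

  complement-induced : ∀ (G : Graph n) k l →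
                       adj (complement (induced G members)) k l ≡ adj (complement G) (ι k) (ι l)
  complement-induced G k l =
    cong (λ b → if b then false else not (adj G (ι k) (ι l)))
         (⌊⌋-⇔ (mk⇔ (cong ι) ι-injective) (k ≟ᶠ l) (ι k ≟ᶠ ι l))

  ∑-split : ∀ (h : Fin n → ℕ) → sum h ≡ sum (h ∘ ι) + sum (λ w → if P w then 0 else h w)
  ∑-split h = begin
    sum h
      ≡⟨ sum-cong-≗ inside+outside ⟩
    sum (λ w → (if P w then h w else 0) + (if P w then 0 else h w))
      ≡⟨ ∑-distrib-+ (λ w → if P w then h w else 0) (λ w → if P w then 0 else h w) ⟩
    sum (λ w → if P w then h w else 0) + sum (λ w → if P w then 0 else h w)
      ≡⟨ cong (_+ sum (λ w → if P w then 0 else h w)) (∑-filter-tabulate id P h) ⟨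
    sum (h ∘ ι) + sum (λ w → if P w then 0 else h w) ∎
    where
    open ≡-Reasoning
    inside+outside : ∀ w → h w ≡ (if P w then h w else 0) + (if P w then 0 else h w)
    inside+outside w with P w
    ... | true  = sym (+-identityʳ (h w))
    ... | false = refl

  deg-cong-members : ∀ (G G′ : Graph n) k → deg (induced G members) k ≡ deg (induced G′ members) k →
                     (∀ w → ¬ T (P w) → adj G (ι k) w ≡ adj G′ (ι k) w) → deg G (ι k) ≡ deg G′ (ι k)
  deg-cong-members G G′ k inside outside = begin
    deg G (ι k)                                              ≡⟨ deg≡∑ G (ι k) ⟩
    sum row                                                  ≡⟨ ∑-split row ⟩
    sum (row ∘ ι) + sum (λ w → if P w then 0 else row w)     ≡⟨ cong₂ _+_ inside′ (sum-cong-≗ outside′) ⟩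
    sum (row′ ∘ ι) + sum (λ w → if P w then 0 else row′ w)   ≡⟨ ∑-split row′ ⟨
    sum row′                                                 ≡⟨ deg≡∑ G′ (ι k) ⟨
    deg G′ (ι k)                                             ∎
    where
    open ≡-Reasoning
    row row′ : Fin n → ℕ
    row  w = indicator (adj G (ι k) w)
    row′ w = indicator (adj G′ (ι k) w)
    inside′ : sum (row ∘ ι) ≡ sum (row′ ∘ ι)
    inside′ = trans (sym (deg≡∑ (induced G members) k)) (trans inside (deg≡∑ (induced G′ members) k))
    outside′ : ∀ w → (if P w then 0 else row w) ≡ (if P w then 0 else row′ w)
    outside′ w with P w in e
    ... | true  = refl
    ... | false = cong indicator (outside w (subst T e))

  restrict : (σ : Permutation′ n) → (∀ v → P (σ ⟨$⟩ʳ v) ≡ P v) →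
             Σ (Permutation′ (length members)) λ ρ → ∀ k → ι (ρ ⟨$⟩ʳ k) ≡ σ ⟨$⟩ʳ ι k
  restrict σ σ-preserves-P = Perm.permutation to from to∘from from∘to , λ k → ι-index _ _
    where
    P-σι : ∀ k → T (P (σ ⟨$⟩ʳ ι k))
    P-σι k = subst T (sym (σ-preserves-P (ι k))) (P-ι k)
    P-σ⁻¹ι : ∀ k → T (P (σ ⟨$⟩ˡ ι k))
    P-σ⁻¹ι k = subst T (trans (sym (cong P (inverseʳ σ))) (σ-preserves-P _)) (P-ι k)
    to from : Fin (length members) → Fin (length members)
    to   k = index (σ ⟨$⟩ʳ ι k) (P-σι k)
    from k = index (σ ⟨$⟩ˡ ι k) (P-σ⁻¹ι k)
    to∘from : ∀ k → to (from k) ≡ k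
    to∘from k = ι-injective (begin
      ι (to (from k))      ≡⟨ ι-index _ _ ⟩
      σ ⟨$⟩ʳ ι (from k)    ≡⟨ cong (σ ⟨$⟩ʳ_) (ι-index _ _) ⟩
      σ ⟨$⟩ʳ (σ ⟨$⟩ˡ ι k)  ≡⟨ inverseʳ σ ⟩
      ι k                  ∎)
      where open ≡-Reasoning
    from∘to : ∀ k → from (to k) ≡ k
    from∘to k = ι-injective (begin
      ι (from (to k))      ≡⟨ ι-index _ _ ⟩
      σ ⟨$⟩ˡ ι (to k)      ≡⟨ cong (σ ⟨$⟩ˡ_) (ι-index _ _) ⟩
      σ ⟨$⟩ˡ (σ ⟨$⟩ʳ ι k)  ≡⟨ inverseˡ σ ⟩
      ι k                  ∎)
      where open ≡-Reasoning

  induced-selfComplementary : ∀ (G : Graph n) (σ : Permutation′ n) → G ≅[ σ ] complement G →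
                              (∀ v → P (σ ⟨$⟩ʳ v) ≡ P v) → SelfComplementary (induced G members)
  induced-selfComplementary G σ G≅Gᶜ σ-preserves-P = ρ , λ k l → begin
    adj (complement (induced G members)) (ρ ⟨$⟩ʳ k) (ρ ⟨$⟩ʳ l)  ≡⟨ complement-induced G _ _ ⟩
    adj (complement G) (ι (ρ ⟨$⟩ʳ k)) (ι (ρ ⟨$⟩ʳ l))           ≡⟨ cong₂ (adj (complement G)) (ι∘ρ k) (ι∘ρ l) ⟩
    adj (complement G) (σ ⟨$⟩ʳ ι k) (σ ⟨$⟩ʳ ι l)               ≡⟨ G≅Gᶜ (ι k) (ι l) ⟩
    adj G (ι k) (ι l)                                         ∎
    where
    open ≡-Reasoning
    ρ = proj₁ (restrict σ σ-preserves-P)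
    ι∘ρ = proj₂ (restrict σ σ-preserves-P)

module Splice {n n′ : ℕ} (G : Graph n) (P : Fin n → Bool) (H : Graph n′)
              (φ : Permutation (length (Members.members P)) n′) where
  open Members P

  private
    adjˢ : Fin n → Fin n → Bool
    adjˢ u w with T? (P u) | T? (P w)
    ... | yes pu | yes pw = adj H (φ ⟨$⟩ʳ index u pu) (φ ⟨$⟩ʳ index w pw)
    ... | _      | _      = adj G u w

    symˢ : ∀ u w → adjˢ u w ≡ adjˢ w u
    symˢ u w with T? (P u) | T? (P w)
    ... | yes _ | yes _ = Graph.sym H _ _
    ... | yes _ | no _  = Graph.sym G u w
    ... | no _  | yes _ = Graph.sym G u w
    ... | no _  | no _  = Graph.sym G u w

    irreflˢ : ∀ v → adjˢ v v ≡ false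
    irreflˢ v with T? (P v)
    ... | yes _ = irrefl H _
    ... | no _  = irrefl G v

  spliced : Graph n
  spliced = record { adj = adjˢ ; sym = symˢ ; irrefl = irreflˢ }

  spliced-inside : ∀ {u w} (pu : T (P u)) (pw : T (P w)) →
                   adj spliced u w ≡ adj H (φ ⟨$⟩ʳ index u pu) (φ ⟨$⟩ʳ index w pw)
  spliced-inside {u} {w} pu pw with T? (P u) | T? (P w)
  ... | yes pu′ | yes pw′ rewrite T-irrelevant pu pu′ | T-irrelevant pw pw′ = refl
  ... | no ¬pu  | _       = ⊥-elim (¬pu pu)
  ... | yes _   | no ¬pw  = ⊥-elim (¬pw pw)

  spliced-outside : ∀ {u w} → ¬ T (P u) ⊎ ¬ T (P w) → adj spliced u w ≡ adj G u w
  spliced-outside {u} {w} out with T? (P u) | T? (P w) | out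
  ... | yes pu | yes _  | inj₁ ¬pu = ⊥-elim (¬pu pu)
  ... | yes _  | yes pw | inj₂ ¬pw = ⊥-elim (¬pw pw)
  ... | yes _  | no _   | _        = refl
  ... | no _   | yes _  | _        = refl
  ... | no _   | no _   | _        = refl

  induced-spliced-≅ : induced spliced members ≅[ φ ] H
  induced-spliced-≅ k l = sym (begin
    adj spliced (ι k) (ι l)
      ≡⟨ spliced-inside (P-ι k) (P-ι l) ⟩
    adj H (φ ⟨$⟩ʳ index (ι k) (P-ι k)) (φ ⟨$⟩ʳ index (ι l) (P-ι l))
      ≡⟨ cong₂ (λ a b → adj H (φ ⟨$⟩ʳ a) (φ ⟨$⟩ʳ b)) (index-ι k _) (index-ι l _) ⟩
    adj H (φ ⟨$⟩ʳ k) (φ ⟨$⟩ʳ l) ∎)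
    where open ≡-Reasoning

  deg-spliced : (∀ k → deg H (φ ⟨$⟩ʳ k) ≡ deg (induced G members) k) → ∀ u → deg spliced u ≡ deg G u
  deg-spliced φ-preserves-deg u = by-membership (T? (P u))
    where
    inside : ∀ k → deg (induced spliced members) k ≡ deg (induced G members) k
    inside k = trans (sym (deg-≅ (induced spliced members) H φ induced-spliced-≅ k)) (φ-preserves-deg k)
    by-membership : Dec (T (P u)) → deg spliced u ≡ deg G u
    by-membership (no ¬pu) = deg-cong spliced G (λ w → spliced-outside (inj₁ ¬pu))
    by-membership (yes pu) =
      subst (λ v → deg spliced v ≡ deg G v) (ι-index u pu)
            (deg-cong-members spliced G (index u pu) (inside (index u pu)) (λ w ¬pw → spliced-outside (inj₂ ¬pw)))

AllPairs-reverse⁺ : ∀ {A : Set} {R : Rel A 0ℓ} {xs} → AllPairs R xs → AllPairs (flip R) (reverse xs)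
AllPairs-reverse⁺ []                          = []
AllPairs-reverse⁺ {R = R} {x ∷ xs} (x~xs ∷ p) =
  subst (AllPairs (flip R)) (sym (unfold-reverse x xs))
        (AllPairsₚ.++⁺ (AllPairs-reverse⁺ p) (All.[] ∷ [])
                       (All.tabulate (λ y∈ → All.lookup x~xs (∈-resp-↭ (↭-reverse xs) y∈) All.∷ All.[])))

AllPairs-deduplicate⁺ : ∀ {xs} → AllPairs _≥_ xs → AllPairs _>_ (deduplicate _≟_ xs)
AllPairs-deduplicate⁺ []                  = []
AllPairs-deduplicate⁺ {x ∷ xs} (x≥xs ∷ p) =
  All.tabulate x>y ∷ AllPairsₚ.filter⁺ (¬? ∘ (x ≟_)) (AllPairs-deduplicate⁺ p)
  where
  x>y : ∀ {y} → y ∈ filter (¬? ∘ (x ≟_)) (deduplicate _≟_ xs) → x > y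
  x>y y∈ with ∈-filter⁻ (¬? ∘ (x ≟_)) y∈
  ... | y∈xs , x≢y = ≤∧≢⇒< (All.lookup x≥xs (∈-deduplicate⁻ _≟_ xs y∈xs)) (x≢y ∘ sym)

lookup-AllPairs : ∀ {A : Set} {R : Rel A 0ℓ} {xs} → AllPairs R xs →
                  ∀ {i j} → i Fin.< j → R (lookup xs i) (lookup xs j)
lookup-AllPairs (x~xs ∷ _) {zero}  {suc j} _         = All.lookup x~xs (∈-lookup j)
lookup-AllPairs (_ ∷ p)    {suc i} {suc j} (s<s i<j) = lookup-AllPairs p i<j

∈⇒lookup : ∀ {A : Set} {x : A} {xs} → x ∈ xs → ∃ λ k → x ≡ lookup xs k
∈⇒lookup x∈ = Any.index x∈ , lookup-index x∈

opposite-< : ∀ {ℓ} {i j : Fin ℓ} → i Fin.< j → opposite j Fin.< opposite i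
opposite-< {i = i} {j} i<j =
  subst₂ _<_ (sym (opposite-prop j)) (sym (opposite-prop i)) (∸-monoʳ-< (s<s i<j) (toℕ<n j))

StrictlyDecreasing : ∀ {ℓ} → (Fin ℓ → ℕ) → Set
StrictlyDecreasing f = ∀ {i j} → i Fin.< j → f j < f i

module _ {ℓ} {f : Fin (ℕ.suc ℓ) → ℕ} (f↓ : StrictlyDecreasing f) where

  strictlyDecreasing-head : ∀ j → f j ≤ f zero
  strictlyDecreasing-head zero    = ≤-refl
  strictlyDecreasing-head (suc j) = <⇒≤ (f↓ z<s)

  strictlyDecreasing-tail : StrictlyDecreasing (f ∘ suc)
  strictlyDecreasing-tail i<j = f↓ (s<s i<j)

  image-tail : ∀ {g : Fin (ℕ.suc ℓ) → ℕ} → f zero ≡ g zero → (∀ i → ∃ λ j → f i ≡ g j) →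
               ∀ i → ∃ λ j → f (suc i) ≡ g (suc j)
  image-tail f₀≡g₀ f⊆g i with f⊆g (suc i)
  ... | zero  , e = ⊥-elim (<-irrefl (trans e (sym f₀≡g₀)) (f↓ z<s))
  ... | suc j , e = j , e

strictlyDecreasing-unique : ∀ {ℓ} {f g : Fin ℓ → ℕ} → StrictlyDecreasing f → StrictlyDecreasing g →
                            (∀ i → ∃ λ j → f i ≡ g j) → (∀ j → ∃ λ i → g j ≡ f i) → ∀ i → f i ≡ g i
strictlyDecreasing-unique {f = f} {g} f↓ g↓ f⊆g g⊆f zero
  with j , f₀≡gⱼ ← f⊆g zero | k , g₀≡fₖ ← g⊆f zero =
  ≤-antisym (subst (_≤ g zero) (sym f₀≡gⱼ) (strictlyDecreasing-head g↓ j))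
            (subst (_≤ f zero) (sym g₀≡fₖ) (strictlyDecreasing-head f↓ k))
strictlyDecreasing-unique f↓ g↓ f⊆g g⊆f (suc i) =
  strictlyDecreasing-unique (strictlyDecreasing-tail f↓) (strictlyDecreasing-tail g↓)
    (image-tail f↓ f₀≡g₀ f⊆g) (image-tail g↓ (sym f₀≡g₀) g⊆f) i
  where
  f₀≡g₀ = strictlyDecreasing-unique f↓ g↓ f⊆g g⊆f zero

complementDegree : ℕ → ℕ → ℕ
complementDegree n d = n ∸ ℕ.suc d

complementDegree-unique : ∀ {n a b} → ℕ.suc (a + b) ≡ n → b ≡ complementDegree n a
complementDegree-unique {a = a} {b} e = trans (sym (m+n∸m≡n (ℕ.suc a) b)) (cong (_∸ ℕ.suc a) e)

suc-+-complementDegree : ∀ {n a} → a < n → ℕ.suc (a + complementDegree n a) ≡ n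
suc-+-complementDegree = m+[n∸m]≡n

complementDegree-involutive : ∀ {n a} → a < n → complementDegree n (complementDegree n a) ≡ a
complementDegree-involutive {n} {a} a<n =
  sym (complementDegree-unique (trans (cong ℕ.suc (+-comm (complementDegree n a) a)) (suc-+-complementDegree a<n)))

complementDegree-< : ∀ {n a b} → a < b → b < n → complementDegree n b < complementDegree n a
complementDegree-< a<b b<n = ∸-monoʳ-< (s<s a<b) b<n

∈-distinctDegrees⁻ : ∀ {n} (G : Graph n) {d} → d ∈ distinctDegrees G → ∃ λ v → d ≡ deg G v
∈-distinctDegrees⁻ G d∈ =
  ∈-tabulate⁻ (∈-resp-↭ (↭-sym (tabulate-deg↭degSeq G)) (∈-deduplicate⁻ _≟_ (degSeq G) d∈))

∈-distinctDegrees⁺ : ∀ {n} (G : Graph n) v → deg G v ∈ distinctDegrees G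
∈-distinctDegrees⁺ G v = ∈-deduplicate⁺ _≟_ (∈-resp-↭ (tabulate-deg↭degSeq G) (∈-tabulate⁺ v))

∈-distinctDegrees⇒<n : ∀ {n} (G : Graph n) {d} → d ∈ distinctDegrees G → d < n
∈-distinctDegrees⇒<n {n} G d∈ with v , d≡dᵥ ← ∈-distinctDegrees⁻ G d∈ =
  subst (_< n) (sym d≡dᵥ) (deg<n G v)

distinctDegrees-strictlyDecreasing : ∀ {n} (G : Graph n) → StrictlyDecreasing (lookup (distinctDegrees G))
distinctDegrees-strictlyDecreasing G =
  lookup-AllPairs (AllPairs-deduplicate⁺ (AllPairs-reverse⁺ (Sorted⇒AllPairs ≤-totalOrder (sort-↗ _))))

complementDegree-∈-distinctDegrees : ∀ {n} (G : Graph n) → SelfComplementary G →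
                                     ∀ {d} → d ∈ distinctDegrees G → complementDegree n d ∈ distinctDegrees G
complementDegree-∈-distinctDegrees {n} G (σ , G≅Gᶜ) {d} d∈ with v , d≡dᵥ ← ∈-distinctDegrees⁻ G d∈ =
  subst (_∈ distinctDegrees G) (complementDegree-unique d+dσᵥ) (∈-distinctDegrees⁺ G (σ ⟨$⟩ʳ v))
  where
  open ≡-Reasoning
  d+dσᵥ : ℕ.suc (d + deg G (σ ⟨$⟩ʳ v)) ≡ n
  d+dσᵥ = begin
    ℕ.suc (d + deg G (σ ⟨$⟩ʳ v))        ≡⟨ cong (λ x → ℕ.suc (x + deg G (σ ⟨$⟩ʳ v))) d≡dᵥ ⟩
    ℕ.suc (deg G v + deg G (σ ⟨$⟩ʳ v))  ≡⟨ cong ℕ.suc (+-comm (deg G v) _) ⟩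
    ℕ.suc (deg G (σ ⟨$⟩ʳ v) + deg G v)  ≡⟨ suc-deg+deg-selfComplementary G σ G≅Gᶜ v ⟩
    n                                   ∎

-- Both i ↦ dᵢ and i ↦ n - 1 - d_{ℓ+1-i} list the distinct degrees in decreasing order.
distinctDegrees-symmetric : ∀ {n} (G : Graph n) → SelfComplementary G → ∀ i →
                            ℕ.suc (lookup (distinctDegrees G) i + lookup (distinctDegrees G) (opposite i)) ≡ n
distinctDegrees-symmetric {n} G G-sc i = begin
  ℕ.suc (f i + f (opposite i))
    ≡⟨ cong (λ d → ℕ.suc (d + f (opposite i))) (strictlyDecreasing-unique f↓ g↓ f⊆g g⊆f i) ⟩
  ℕ.suc (g i + f (opposite i))
    ≡⟨ cong ℕ.suc (+-comm (g i) _) ⟩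
  ℕ.suc (f (opposite i) + g i)
    ≡⟨ suc-+-complementDegree (f<n (opposite i)) ⟩
  n ∎
  where
  open ≡-Reasoning
  co = complementDegree n
  f g : Fin (numDegrees G) → ℕ
  f = lookup (distinctDegrees G)
  g = co ∘ f ∘ opposite
  f<n : ∀ k → f k < n
  f<n k = ∈-distinctDegrees⇒<n G (∈-lookup k)
  f↓ : StrictlyDecreasing f
  f↓ = distinctDegrees-strictlyDecreasing G
  g↓ : StrictlyDecreasing g
  g↓ {i} {j} i<j = complementDegree-< (f↓ (opposite-< i<j)) (f<n (opposite j))
  f⊆g : ∀ i → ∃ λ j → f i ≡ g j
  f⊆g i with k , co-fᵢ≡fₖ ← ∈⇒lookup (complementDegree-∈-distinctDegrees G G-sc (∈-lookup i)) =
    opposite k , (begin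
      f i                             ≡⟨ complementDegree-involutive (f<n i) ⟨
      co (co (f i))                   ≡⟨ cong co co-fᵢ≡fₖ ⟩
      co (f k)                        ≡⟨ cong (co ∘ f) (opposite-involutive k) ⟨
      co (f (opposite (opposite k)))  ∎)
  g⊆f : ∀ j → ∃ λ i → g j ≡ f i
  g⊆f j = ∈⇒lookup (complementDegree-∈-distinctDegrees G G-sc (∈-lookup (opposite j)))

m+n≡o+p⇒[m≡o⇔n≡p] : ∀ {m n o p} → m + n ≡ o + p → (m ≡ o) ⇔ (n ≡ p)
m+n≡o+p⇒[m≡o⇔n≡p] {m} {n} {o} {p} e = mk⇔
  (λ m≡o → +-cancelˡ-≡ o n p (subst (λ x → x + n ≡ o + p) m≡o e))
  (λ n≡p → +-cancelʳ-≡ p m o (subst (λ x → m + x ≡ o + p) n≡p e))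

-- proj₂ (slice G i) is, definitionally, induced G (Members.members (inSlice G i)).
inSlice : ∀ {n} (G : Graph n) → Fin (numDegrees G) → Fin n → Bool
inSlice G i v = ⌊ deg G v ≟ lookup ds i ⌋ ∨ ⌊ deg G v ≟ lookup ds (opposite i) ⌋
  where ds = distinctDegrees G

inSlice-swap : ∀ {n} (G : Graph n) → SelfComplementary G → ∀ i {u v} →
               ℕ.suc (deg G u + deg G v) ≡ n → inSlice G i u ≡ inSlice G i v
inSlice-swap G G-sc i {u} {v} e = begin
  ⌊ deg G u ≟ a ⌋ ∨ ⌊ deg G u ≟ b ⌋
    ≡⟨ cong₂ _∨_ (⌊⌋-⇔ (m+n≡o+p⇒[m≡o⇔n≡p] a+b) (deg G u ≟ a) (deg G v ≟ b))
                 (⌊⌋-⇔ (m+n≡o+p⇒[m≡o⇔n≡p] b+a) (deg G u ≟ b) (deg G v ≟ a)) ⟩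
  ⌊ deg G v ≟ b ⌋ ∨ ⌊ deg G v ≟ a ⌋
    ≡⟨ ∨-comm ⌊ deg G v ≟ b ⌋ _ ⟩
  ⌊ deg G v ≟ a ⌋ ∨ ⌊ deg G v ≟ b ⌋ ∎
  where
  open ≡-Reasoning
  a = lookup (distinctDegrees G) i
  b = lookup (distinctDegrees G) (opposite i)
  a+b : deg G u + deg G v ≡ a + b
  a+b = ℕₚ.suc-injective (trans e (sym (distinctDegrees-symmetric G G-sc i)))
  b+a : deg G u + deg G v ≡ b + a
  b+a = trans a+b (+-comm a b)

lemma16 : (τ : List ℕ) → ForciblySelfComplementary τ →
          ∀ n (G : Graph n) → Realizes G τ →
          (i : Fin (numDegrees G)) → ForciblySelfComplementary (degSeq (proj₂ (slice G i)))
lemma16 τ τ-fsc n G G⊢τ i n′ H H⊢Sᵢ =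
  selfComplementary-≅ (induced spliced members) H φ induced-spliced-≅
    (induced-selfComplementary spliced σ G′≅G′ᶜ σ-preserves-slice)
  where
  open Members (inSlice G i)
  φ-match = degSeq-≡⇒degree-preserving-bijection (induced G members) H (sym H⊢Sᵢ)
  φ = proj₁ φ-match
  open Splice G (inSlice G i) H φ
  deg-G′ = deg-spliced (proj₂ φ-match)
  G′-sc = τ-fsc n spliced (trans (degSeq-cong spliced G deg-G′) G⊢τ)
  σ = proj₁ G′-sc
  G′≅G′ᶜ = proj₂ G′-sc
  σ-preserves-slice : ∀ v → inSlice G i (σ ⟨$⟩ʳ v) ≡ inSlice G i v
  σ-preserves-slice v = inSlice-swap G (τ-fsc n G G⊢τ) i
    (subst₂ (λ d d′ → ℕ.suc (d + d′) ≡ n) (deg-G′ (σ ⟨$⟩ʳ v)) (deg-G′ v)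
            (suc-deg+deg-selfComplementary spliced σ G′≅G′ᶜ v))
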